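{- Let $n \ge 1$, let $S_1, \ldots, S_n$ be finite sets with $|S_k| \ge 2$ for each $k$, let $Q = S_1 \times \cdots \times S_n$, let $\delta \in [0,1/2]$, let $\mathcal{A}$ be a collection of hyperplanes in $Q$, and let $\mathbb{P}_0, \ldots, \mathbb{P}_n$ be defined from $\mathcal{A}$ and $\delta$ as in the context. Let $A$ be any hyperplane in $Q$ and let $0 \le k \le n$. If $F(A) \subseteq \{1, \ldots, k\}$, then $$\mathbb{P}_k(A) \le \prod_{j \in F(A)} \frac{1}{(1-\delta)|S_j|}.$$
   Context: For $0 \le k \le n$ let $Q_k = S_1 \times \cdots \times S_k$ ($Q_0$ is a one-point set). A hyperplane in $Q$ is a set $A = Y_1 \times \cdots \times Y_n$ where each $Y_i$ is either $S_i$ or a single element of $S_i$; its set of fixed coordinates is $F(A) = \{k : Y_k \ne S_k\}$. A subset $X \subseteq Q_k$ is identified with $X \times S_{k+1} \times \cdots \times S_n \subseteq Q$. For $1 \le k \le n$ let $\mathcal{A}_k = \{A \in \mathcal{A} : \max F(A) = k\}$ and $B_k = \bigcup_{A \in \mathcal{A}_k} A$, regarded as a subset of $Q_k$. Write elements of $Q_k$ as pairs $(x,y)$ with $x \in Q_{k-1}$, $y \in S_k$. For $x \in Q_{k-1}$ set $\alpha_k(x) = |\{y \in S_k : (x,y) \in B_k\}| / |S_k|$. Define probability measures $\mathbb{P}_k$ on $Q_k$ recursively: $\mathbb{P}_0$ is the unique probability measure on $Q_0$, and for $1 \le k \le n$ and $(x,y) \in Q_k$, $$\mathbb{P}_k(x,y)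 = \max\Big\{0, \frac{\alpha_k(x) - \delta}{\alpha_k(x)(1-\delta)}\Big\} \cdot \frac{\mathbb{P}_{k-1}(x)}{|S_k|} \text{ if } (x,y) \in B_k,$$ $$\mathbb{P}_k(x,y) = \min\Big\{\frac{1}{1-\alpha_k(x)}, \frac{1}{1-\delta}\Big\} \cdot \frac{\mathbb{P}_{k-1}(x)}{|S_k|} \text{ if } (x,y) \notin B_k.$$ Each $\mathbb{P}_k$ is extended to a probability measure on $Q$ uniformly, i.e. $\mathbb{P}_k(x,z) = \mathbb{P}_k(x)/(|S_{k+1}|\cdots|S_n|)$ for $x \in Q_k$, $z \in S_{k+1}\times\cdots\times S_n$; thus $\mathbb{P}_k(A)$ denotes the measure of $A \subseteq Q$ under this extension.
   Formalization: The parameter δ takes only rational values in the interval [0,1/2]. -}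

module Defs where

open import Data.Nat as ℕ using (ℕ; zero; suc)
open import Data.Fin as Fin using (Fin; zero; suc; toℕ; fromℕ<)
open import Data.Maybe using (Maybe; just; nothing; is-just)
open import Data.Bool using (Bool; true; false; if_then_else_; _∧_; _∨_; not)
open import Data.List using (List; []; _∷_; map; concatMap; foldr)
open import Data.Integer using (+_)
open import Data.Rational as ℚ using (ℚ; 0ℚ; 1ℚ; _+_; _*_; _-_; _⊔_; _⊓_; _/_)
open import Data.Rational.Properties as ℚP using ()
open import Relation.Nullary using (yes; no)
open import Relation.Nullary.Decidable using (⌊_⌋)
open import Relation.Binary.PropositionalEquality using (refl)

-- Q = S_1 × ⋯ × S_n with S_i = Fin (s i) (coordinate i+1 of the paper is Fin index i)
Point : (n : ℕ) → (Fin n → ℕ) → Set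
Point n s = (i : Fin n) → Fin (s i)

-- hyperplane: nothing = the whole S_i, just a = the singleton {a}
Hyperplane : (n : ℕ) → (Fin n → ℕ) → Set
Hyperplane n s = (i : Fin n) → Maybe (Fin (s i))

allB : ∀ {m} → (Fin m → Bool) → Bool
allB {zero} f = true
allB {suc m} f = f zero ∧ allB (λ i → f (suc i))

anyL : ∀ {a} {A : Set a} → (A → Bool) → List A → Bool
anyL f [] = false
anyL f (x ∷ xs) = f x ∨ anyL f xs

countB : ∀ {m} → (Fin m → Bool) → ℕ
countB {zero} f = 0
countB {suc m} f = (if f zero then 1 else 0) ℕ.+ countB (λ i → f (suc i))

ℕ→ℚ : ℕ → ℚ
ℕ→ℚ m = (+ m) / 1

-- total reciprocal (1/0 := 0); only ever applied to non-zero values in the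
-- cases that matter for the definition of ℙ_k
inv : ℚ → ℚ
inv q with q ℚP.≟ 0ℚ
... | yes _ = 0ℚ
... | no q≢0 = ℚ.1/_ q {{ℚ.≢-nonZero q≢0}}

sumF : ∀ {m} → (Fin m → ℚ) → ℚ
sumF {zero} f = 0ℚ
sumF {suc m} f = f zero + sumF (λ i → f (suc i))

prodF : ∀ {m} → (Fin m → ℚ) → ℚ
prodF {zero} f = 1ℚ
prodF {suc m} f = f zero * prodF (λ i → f (suc i))

module _ {n : ℕ} {s : Fin n → ℕ} where

  fixed : Hyperplane n s → Fin n → Bool
  fixed A i = is-just (A i)

  inA : Hyperplane n s → Point n s → Bool
  inA A q = allB (λ i → check i (A i))
    where
    check : (i : Fin n) → Maybe (Fin (s i)) → Bool
    check i nothing = true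
    check i (just a) = ⌊ q i Fin.≟ a ⌋

  maxFis : Hyperplane n s → Fin n → Bool
  maxFis A i = fixed A i ∧ allB (λ j → not (toℕ i ℕ.<ᵇ toℕ j) ∨ not (fixed A j))

  -- q ∈ B_{i+1} (membership depends only on coordinates 0..i of q)
  inB : List (Hyperplane n s) → Fin n → Point n s → Bool
  inB 𝒜 i q = anyL (λ A → maxFis A i ∧ inA A q) 𝒜

  upd : Point n s → (i : Fin n) → Fin (s i) → Point n s
  upd q i y j with j Fin.≟ i
  ... | yes refl = y
  ... | no _ = q j

  sizeQ : ℕ
  sizeQ = foldr ℕ._*_ 1 (map s (Data.List.allFin n))
    where import Data.List

  -- ℙ_k, extended uniformly to Q, as a function of a point of Q
  -- (ℙ_k(x,y,z) = factor_k(x,y) · ℙ_{k-1}(x,y,z), which is the recursion of the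
  --  paper after the uniform extension).  For k > n we set ℙ_k = ℙ_{k-1} (unused).
  Pk : List (Hyperplane n s) → ℚ → ℕ → Point n s → ℚ
  Pk 𝒜 δ zero q = inv (ℕ→ℚ sizeQ)
  Pk 𝒜 δ (suc k) q with k ℕ.<? n
  ... | no _ = Pk 𝒜 δ k q
  ... | yes k<n = factor * Pk 𝒜 δ k q
    where
    i : Fin n
    i = fromℕ< k<n
    α : ℚ
    α = ℕ→ℚ (countB (λ y → inB 𝒜 i (upd q i y))) * inv (ℕ→ℚ (s i))
    factor : ℚ
    factor = if inB 𝒜 i q
             then 0ℚ ⊔ ((α - δ) * inv (α * (1ℚ - δ)))
             else (inv (1ℚ - α) ⊓ inv (1ℚ - δ))

  allPoints : ∀ {m} {t : Fin m → ℕ} → List (Point m t)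
  allPoints {zero} {t} = (λ ()) ∷ []
  allPoints {suc m} {t} =
    concatMap (λ (y : Fin (t zero)) → map (cons y) (allPoints {m} {λ i → t (suc i)}))
              (Data.List.allFin (t zero))
    where
    import Data.List
    cons : Fin (t zero) → Point m (λ i → t (suc i)) → Point (suc m) t
    cons y r zero = y
    cons y r (suc i) = r i

  sumL : List ℚ → ℚ
  sumL = foldr _+_ 0ℚ

  measure : List (Hyperplane n s) → ℚ → ℕ → Hyperplane n s → ℚ
  measure 𝒜 δ k A = sumL (map (λ q → if inA A q then Pk 𝒜 δ k q else 0ℚ) (allPoints {n} {s}))

  bound : ℚ → Hyperplane n s → ℚ
  bound δ A = prodF (λ j → if fixed A j then inv ((1ℚ - δ) * ℕ→ℚ (s j)) else 1ℚ)

{-# OPTIONS --safe #-}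
-- We prove the stronger bound ℙ_k(A) ≤ ∏_{j ∈ F(A)} 1/c_k(j) for every hyperplane A, where
-- c_k(j) = (1-δ)|S_j| for j ≤ k and c_k(j) = |S_j| for j > k, by induction on k. For k = 0
-- this is an equality, since ℙ_0 is uniform. The density of ℙ_k is that of ℙ_{k-1} times a
-- factor that depends only on the first k coordinates and never exceeds 1/(1-δ). If k ∈ F(A)
-- this costs exactly the extra 1/(1-δ) in c_k(k). If k ∉ F(A), then A is a union of whole
-- fibres {x} × S_k, and on each fibre the factor averages to at most 1 (to exactly 1 once
-- α_k(x) > δ), so the measure of A does not grow.
module Submission where

open import Defs
open import Data.Nat using (ℕ; _≤_; _<_)
open import Data.Fin using (Fin; toℕ)
open import Data.Bool using (true)
open import Data.List using (List)
open import Data.Rational using (ℚ; 0ℚ; ½)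
open import Relation.Binary.PropositionalEquality using (_≡_)

open import Data.Nat as ℕ using (zero; suc; z≤n; s≤s)
import Data.Nat.Properties as ℕP
import Data.Nat.Coprimality as Coprimality
import Data.Integer as ℤ
import Data.Integer.Properties as ℤP
import Data.Rational as Q
open Q using (1ℚ; mkℚ; _+_; _*_; _-_; _⊔_; _⊓_)
import Data.Rational.Properties as ℚP
open import Data.Rational.Solver using (module +-*-Solver)
open import Data.Fin as Fin using (zero; suc; fromℕ<)
import Data.Fin.Properties as FinP
open import Data.Maybe using (Maybe; just; nothing; is-just)
open import Data.Bool using (Bool; false; if_then_else_; _∧_; _∨_; not; T)
open import Data.Bool.Properties using (T-≡)
import Data.List as L
open L using ([]; _∷_; map; _++_; concatMap; tabulate)
import Data.List.Properties as ListP
open import Data.Empty using (⊥-elim)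
open import Data.Product using (Σ; _,_; _×_; proj₁; proj₂)
open import Function.Bundles using (module Equivalence)
open import Relation.Nullary using (yes; no; Dec)
open import Relation.Nullary.Decidable using (⌊_⌋)
open import Relation.Binary.PropositionalEquality
open +-*-Solver

ℕ→ℚ≡mkℚ : ∀ m → ℕ→ℚ m ≡ mkℚ (ℤ.+ m) 0 (Coprimality.sym (Coprimality.1-coprimeTo m))
ℕ→ℚ≡mkℚ m = ℚP.↥p/↧p≡p (mkℚ (ℤ.+ m) 0 (Coprimality.sym (Coprimality.1-coprimeTo m)))

ℕ→ℚ-suc : ∀ m → ℕ→ℚ (suc m) ≡ 1ℚ + ℕ→ℚ m
ℕ→ℚ-suc m rewrite ℕ→ℚ≡mkℚ m =
  ℚP./-cong {ℤ.+ suc m} {1} {(ℤ.+ 1) ℤ.* (ℤ.+ 1) ℤ.+ (ℤ.+ m) ℤ.* (ℤ.+ 1)} {1}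
    (cong (λ z → ℤ.+ 1 ℤ.+ z) (sym (ℤP.*-identityʳ (ℤ.+ m)))) refl

ℕ→ℚ-+ : ∀ a b → ℕ→ℚ (a ℕ.+ b) ≡ ℕ→ℚ a + ℕ→ℚ b
ℕ→ℚ-+ zero b = sym (ℚP.+-identityˡ (ℕ→ℚ b))
ℕ→ℚ-+ (suc a) b = begin
  ℕ→ℚ (suc (a ℕ.+ b))    ≡⟨ ℕ→ℚ-suc (a ℕ.+ b) ⟩
  1ℚ + ℕ→ℚ (a ℕ.+ b)     ≡⟨ cong (1ℚ +_) (ℕ→ℚ-+ a b) ⟩
  1ℚ + (ℕ→ℚ a + ℕ→ℚ b)   ≡⟨ ℚP.+-assoc 1ℚ (ℕ→ℚ a) (ℕ→ℚ b) ⟨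
  (1ℚ + ℕ→ℚ a) + ℕ→ℚ b   ≡⟨ cong (_+ ℕ→ℚ b) (ℕ→ℚ-suc a) ⟨
  ℕ→ℚ (suc a) + ℕ→ℚ b    ∎
  where open ≡-Reasoning

ℕ→ℚ-* : ∀ a b → ℕ→ℚ (a ℕ.* b) ≡ ℕ→ℚ a * ℕ→ℚ b
ℕ→ℚ-* zero b = sym (ℚP.*-zeroˡ (ℕ→ℚ b))
ℕ→ℚ-* (suc a) b = begin
  ℕ→ℚ (b ℕ.+ a ℕ.* b)      ≡⟨ ℕ→ℚ-+ b (a ℕ.* b) ⟩
  ℕ→ℚ b + ℕ→ℚ (a ℕ.* b)    ≡⟨ cong (ℕ→ℚ b +_) (ℕ→ℚ-* a b) ⟩
  ℕ→ℚ b + ℕ→ℚ a * ℕ→ℚ b    ≡⟨ solve 2 (λ x y → y :+ x :* y := (con 1ℚ :+ x) :* y) refl (ℕ→ℚ a) (ℕ→ℚ b) ⟩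
  (1ℚ + ℕ→ℚ a) * ℕ→ℚ b     ≡⟨ cong (_* ℕ→ℚ b) (ℕ→ℚ-suc a) ⟨
  ℕ→ℚ (suc a) * ℕ→ℚ b      ∎
  where open ≡-Reasoning

ℕ→ℚ-nonNeg : ∀ m → 0ℚ Q.≤ ℕ→ℚ m
ℕ→ℚ-nonNeg m rewrite ℕ→ℚ≡mkℚ m = ℚP.nonNegative⁻¹ _

ℕ→ℚ-suc-pos : ∀ m → 0ℚ Q.< ℕ→ℚ (suc m)
ℕ→ℚ-suc-pos m rewrite ℕ→ℚ≡mkℚ (suc m) = ℚP.positive⁻¹ _

ℕ→ℚ-mono-≤ : ∀ {a b} → a ℕ.≤ b → ℕ→ℚ a Q.≤ ℕ→ℚ b
ℕ→ℚ-mono-≤ {a} {b} a≤b = begin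
  ℕ→ℚ a                    ≡⟨ ℚP.+-identityʳ (ℕ→ℚ a) ⟨
  ℕ→ℚ a + 0ℚ               ≤⟨ ℚP.+-monoʳ-≤ (ℕ→ℚ a) (ℕ→ℚ-nonNeg (b ℕ.∸ a)) ⟩
  ℕ→ℚ a + ℕ→ℚ (b ℕ.∸ a)    ≡⟨ ℕ→ℚ-+ a (b ℕ.∸ a) ⟨
  ℕ→ℚ (a ℕ.+ (b ℕ.∸ a))    ≡⟨ cong ℕ→ℚ (ℕP.m+[n∸m]≡n a≤b) ⟩
  ℕ→ℚ b                    ∎
  where open ℚP.≤-Reasoning

*-monoˡ-≤-0≤ : ∀ {r p q} → 0ℚ Q.≤ r → p Q.≤ q → r * p Q.≤ r * q
*-monoˡ-≤-0≤ {r} 0≤r = ℚP.*-monoˡ-≤-nonNeg r {{Q.nonNegative 0≤r}}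

*-monoʳ-≤-0≤ : ∀ {r p q} → 0ℚ Q.≤ r → p Q.≤ q → p * r Q.≤ q * r
*-monoʳ-≤-0≤ {r} 0≤r = ℚP.*-monoʳ-≤-nonNeg r {{Q.nonNegative 0≤r}}

0≤*0≤⇒0≤ : ∀ {p q} → 0ℚ Q.≤ p → 0ℚ Q.≤ q → 0ℚ Q.≤ p * q
0≤*0≤⇒0≤ {p} 0≤p 0≤q = ℚP.≤-trans (ℚP.≤-reflexive (sym (ℚP.*-zeroʳ p))) (*-monoˡ-≤-0≤ 0≤p 0≤q)

≤0*0≤⇒≤0 : ∀ {p q} → p Q.≤ 0ℚ → 0ℚ Q.≤ q → p * q Q.≤ 0ℚ
≤0*0≤⇒≤0 {q = q} p≤0 0≤q = ℚP.≤-trans (*-monoʳ-≤-0≤ 0≤q p≤0) (ℚP.≤-reflexive (ℚP.*-zeroˡ q))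

p≤q⇒0≤q-p : ∀ {p q} → p Q.≤ q → 0ℚ Q.≤ q - p
p≤q⇒0≤q-p {p} p≤q = ℚP.≤-trans (ℚP.≤-reflexive (sym (ℚP.+-inverseʳ p))) (ℚP.+-monoˡ-≤ (Q.- p) p≤q)

p<q⇒0<q-p : ∀ {p q} → p Q.< q → 0ℚ Q.< q - p
p<q⇒0<q-p {p} p<q = ℚP.≤-<-trans (ℚP.≤-reflexive (sym (ℚP.+-inverseʳ p))) (ℚP.+-monoˡ-< (Q.- p) p<q)

p≤q⇒p-q≤0 : ∀ {p q} → p Q.≤ q → p - q Q.≤ 0ℚ
p≤q⇒p-q≤0 {q = q} p≤q = ℚP.≤-trans (ℚP.+-monoˡ-≤ (Q.- q) p≤q) (ℚP.≤-reflexive (ℚP.+-inverseʳ q))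

0≤q⇒p-q≤p : ∀ {p q} → 0ℚ Q.≤ q → p - q Q.≤ p
0≤q⇒p-q≤p {p} {q} 0≤q = begin
  p - q        ≤⟨ ℚP.+-monoʳ-≤ p (ℚP.neg-antimono-≤ 0≤q) ⟩
  p + Q.- 0ℚ   ≡⟨ ℚP.+-identityʳ p ⟩
  p            ∎
  where open ℚP.≤-Reasoning

0<⇒≢0 : ∀ {p} → 0ℚ Q.< p → p ≢ 0ℚ
0<⇒≢0 0<p p≡0 = ℚP.<-irrefl (sym p≡0) 0<p

0≤∧≢0⇒0< : ∀ {p} → 0ℚ Q.≤ p → p ≢ 0ℚ → 0ℚ Q.< p
0≤∧≢0⇒0< {p} 0≤p p≢0 with 0ℚ ℚP.<? p
... | yes 0<p = 0<p
... | no 0≮p = ⊥-elim (p≢0 (ℚP.≤-antisym (ℚP.≮⇒≥ 0≮p) 0≤p))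

inv-inverseʳ : ∀ p → p ≢ 0ℚ → p * inv p ≡ 1ℚ
inv-inverseʳ p p≢0 with p ℚP.≟ 0ℚ
... | yes p≡0 = ⊥-elim (p≢0 p≡0)
... | no p≢0′ = ℚP.*-inverseʳ p {{Q.≢-nonZero p≢0′}}

inv-nonNeg : ∀ {p} → 0ℚ Q.≤ p → 0ℚ Q.≤ inv p
inv-nonNeg {p} 0≤p with p ℚP.≟ 0ℚ
... | yes _ = ℚP.≤-refl
... | no p≢0 = ℚP.<⇒≤ (ℚP.positive⁻¹ _ {{ℚP.1/pos⇒pos p {{Q.positive (0≤∧≢0⇒0< 0≤p p≢0)}}}})

-- Also true when p or q vanishes, because inv 0ℚ is 0ℚ.
inv-* : ∀ p q → inv (p * q) ≡ inv p * inv q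
inv-* p q = by-cases (p ℚP.≟ 0ℚ) (q ℚP.≟ 0ℚ)
  where
  open ≡-Reasoning
  by-cases : Dec (p ≡ 0ℚ) → Dec (q ≡ 0ℚ) → inv (p * q) ≡ inv p * inv q
  by-cases (yes refl) _ = trans (cong inv (ℚP.*-zeroˡ q)) (sym (ℚP.*-zeroˡ (inv q)))
  by-cases (no _) (yes refl) = trans (cong inv (ℚP.*-zeroʳ p)) (sym (ℚP.*-zeroʳ (inv p)))
  by-cases (no p≢0) (no q≢0) = begin
    inv (p * q)                                  ≡⟨ ℚP.*-identityʳ (inv (p * q)) ⟨
    inv (p * q) * 1ℚ                             ≡⟨ cong (inv (p * q) *_) pq*inv≡1 ⟨
    inv (p * q) * ((p * q) * (inv p * inv q))    ≡⟨ solve 3 (λ x y z → x :* (y :* z) := (y :* x) :* z) refl (inv (p * q)) (p * q) (inv p * inv q) ⟩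
    ((p * q) * inv (p * q)) * (inv p * inv q)    ≡⟨ cong (_* (inv p * inv q)) (inv-inverseʳ (p * q) pq≢0) ⟩
    1ℚ * (inv p * inv q)                         ≡⟨ ℚP.*-identityˡ (inv p * inv q) ⟩
    inv p * inv q                                ∎
    where
    pq*inv≡1 : (p * q) * (inv p * inv q) ≡ 1ℚ
    pq*inv≡1 = begin
      (p * q) * (inv p * inv q)    ≡⟨ solve 4 (λ a b c d → (a :* b) :* (c :* d) := (a :* c) :* (b :* d)) refl p q (inv p) (inv q) ⟩
      (p * inv p) * (q * inv q)    ≡⟨ cong₂ _*_ (inv-inverseʳ p p≢0) (inv-inverseʳ q q≢0) ⟩
      1ℚ                           ∎
    pq≢0 : p * q ≢ 0ℚ
    pq≢0 pq≡0 = ℚP.1≢0 (trans (sym pq*inv≡1) (trans (cong (_* (inv p * inv q)) pq≡0) (ℚP.*-zeroˡ (inv p * inv q))))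

module Factors (δ : ℚ) (0≤δ : 0ℚ Q.≤ δ) (δ<1 : δ Q.< 1ℚ) where

  0<1-δ : 0ℚ Q.< (1ℚ - δ)
  0<1-δ = p<q⇒0<q-p δ<1

  0≤inv[1-δ] : 0ℚ Q.≤ inv (1ℚ - δ)
  0≤inv[1-δ] = inv-nonNeg (ℚP.<⇒≤ 0<1-δ)

  factorIn : ℚ → ℚ
  factorIn α = 0ℚ ⊔ ((α - δ) * inv (α * (1ℚ - δ)))

  factorOut : ℚ → ℚ
  factorOut α = inv (1ℚ - α) ⊓ inv (1ℚ - δ)

  factor : Bool → ℚ → ℚ
  factor b α = if b then factorIn α else factorOut α

  factor-nonNeg : ∀ b {α} → α Q.≤ 1ℚ → 0ℚ Q.≤ factor b α
  factor-nonNeg true {α} _ = ℚP.p≤p⊔q 0ℚ ((α - δ) * inv (α * (1ℚ - δ)))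
  factor-nonNeg false α≤1 = ℚP.⊓-glb (inv-nonNeg (p≤q⇒0≤q-p α≤1)) 0≤inv[1-δ]

  factorOut≤inv[1-δ] : ∀ α → factorOut α Q.≤ inv (1ℚ - δ)
  factorOut≤inv[1-δ] α = ℚP.p⊓q≤q (inv (1ℚ - α)) (inv (1ℚ - δ))

  gain≡ : ∀ α → (α - δ) * inv (α * (1ℚ - δ)) ≡ ((α - δ) * inv α) * inv (1ℚ - δ)
  gain≡ α = trans (cong ((α - δ) *_) (inv-* α (1ℚ - δ))) (sym (ℚP.*-assoc (α - δ) (inv α) (inv (1ℚ - δ))))

  gain≤0 : ∀ {α} → 0ℚ Q.≤ α → α Q.≤ δ → (α - δ) * inv (α * (1ℚ - δ)) Q.≤ 0ℚ
  gain≤0 0≤α α≤δ = ≤0*0≤⇒≤0 (p≤q⇒p-q≤0 α≤δ) (inv-nonNeg (0≤*0≤⇒0≤ 0≤α (ℚP.<⇒≤ 0<1-δ)))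

  gain≥0 : ∀ {α} → 0ℚ Q.≤ α → δ Q.< α → 0ℚ Q.≤ (α - δ) * inv (α * (1ℚ - δ))
  gain≥0 0≤α δ<α = 0≤*0≤⇒0≤ (p≤q⇒0≤q-p (ℚP.<⇒≤ δ<α)) (inv-nonNeg (0≤*0≤⇒0≤ 0≤α (ℚP.<⇒≤ 0<1-δ)))

  factorIn≤inv[1-δ] : ∀ {α} → 0ℚ Q.≤ α → factorIn α Q.≤ inv (1ℚ - δ)
  factorIn≤inv[1-δ] {α} 0≤α with α ℚP.≤? δ
  ... | yes α≤δ = ℚP.⊔-lub 0≤inv[1-δ] (ℚP.≤-trans (gain≤0 0≤α α≤δ) 0≤inv[1-δ])
  ... | no α≰δ = ℚP.⊔-lub 0≤inv[1-δ] (begin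
      (α - δ) * inv (α * (1ℚ - δ))       ≡⟨ gain≡ α ⟩
      ((α - δ) * inv α) * inv (1ℚ - δ)   ≤⟨ *-monoʳ-≤-0≤ 0≤inv[1-δ] [α-δ]/α≤1 ⟩
      1ℚ * inv (1ℚ - δ)                  ≡⟨ ℚP.*-identityˡ (inv (1ℚ - δ)) ⟩
      inv (1ℚ - δ)                       ∎)
    where
    open ℚP.≤-Reasoning
    0<α : 0ℚ Q.< α
    0<α = ℚP.≤-<-trans 0≤δ (ℚP.≰⇒> α≰δ)
    [α-δ]/α≤1 : (α - δ) * inv α Q.≤ 1ℚ
    [α-δ]/α≤1 = ℚP.≤-trans (*-monoʳ-≤-0≤ (inv-nonNeg 0≤α) (0≤q⇒p-q≤p {α} 0≤δ))
                           (ℚP.≤-reflexive (inv-inverseʳ α (0<⇒≢0 0<α)))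

  factor≤inv[1-δ] : ∀ b {α} → 0ℚ Q.≤ α → factor b α Q.≤ inv (1ℚ - δ)
  factor≤inv[1-δ] true 0≤α = factorIn≤inv[1-δ] 0≤α
  factor≤inv[1-δ] false {α} _ = factorOut≤inv[1-δ] α

  -- Once α > δ the fraction α of B_k loses exactly the mass the rest gains:
  -- α · (α - δ)/(α(1 - δ)) + (1 - α)/(1 - δ) = 1.
  factor-average≤1 : ∀ {α} → 0ℚ Q.≤ α → α Q.≤ 1ℚ → α * factorIn α + (1ℚ - α) * factorOut α Q.≤ 1ℚ
  factor-average≤1 {α} 0≤α α≤1 with α ℚP.≤? δ
  ... | yes α≤δ = begin
      α * factorIn α + (1ℚ - α) * factorOut α   ≡⟨ cong (λ z → α * z + (1ℚ - α) * factorOut α) (ℚP.p≥q⇒p⊔q≡p (gain≤0 0≤α α≤δ)) ⟩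
      α * 0ℚ + (1ℚ - α) * factorOut α           ≡⟨ cong (_+ (1ℚ - α) * factorOut α) (ℚP.*-zeroʳ α) ⟩
      0ℚ + (1ℚ - α) * factorOut α               ≡⟨ ℚP.+-identityˡ ((1ℚ - α) * factorOut α) ⟩
      (1ℚ - α) * factorOut α                    ≤⟨ *-monoˡ-≤-0≤ (ℚP.<⇒≤ 0<1-α) (ℚP.p⊓q≤p (inv (1ℚ - α)) (inv (1ℚ - δ))) ⟩
      (1ℚ - α) * inv (1ℚ - α)                   ≡⟨ inv-inverseʳ (1ℚ - α) (0<⇒≢0 0<1-α) ⟩
      1ℚ                                        ∎
    where
    open ℚP.≤-Reasoning
    0<1-α : 0ℚ Q.< 1ℚ - α
    0<1-α = p<q⇒0<q-p (ℚP.≤-<-trans α≤δ δ<1)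
  ... | no α≰δ = begin
      α * factorIn α + (1ℚ - α) * factorOut α
        ≡⟨ cong (λ z → α * z + (1ℚ - α) * factorOut α) (ℚP.p≤q⇒p⊔q≡q (gain≥0 0≤α δ<α)) ⟩
      α * gain + (1ℚ - α) * factorOut α
        ≤⟨ ℚP.+-monoʳ-≤ (α * gain) (*-monoˡ-≤-0≤ (p≤q⇒0≤q-p α≤1) (factorOut≤inv[1-δ] α)) ⟩
      α * gain + (1ℚ - α) * inv (1ℚ - δ)
        ≡⟨ cong (_+ (1ℚ - α) * inv (1ℚ - δ)) α*gain≡ ⟩
      1ℚ * ((α - δ) * inv (1ℚ - δ)) + (1ℚ - α) * inv (1ℚ - δ)
        ≡⟨ solve 3 (λ a d i → con 1ℚ :* ((a :- d) :* i) :+ (con 1ℚ :- a) :* i := (con 1ℚ :- d) :* i) refl α δ (inv (1ℚ - δ)) ⟩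
      (1ℚ - δ) * inv (1ℚ - δ)
        ≡⟨ inv-inverseʳ (1ℚ - δ) (0<⇒≢0 0<1-δ) ⟩
      1ℚ ∎
    where
    open ℚP.≤-Reasoning
    gain : ℚ
    gain = (α - δ) * inv (α * (1ℚ - δ))
    δ<α : δ Q.< α
    δ<α = ℚP.≰⇒> α≰δ
    α*gain≡ : α * gain ≡ 1ℚ * ((α - δ) * inv (1ℚ - δ))
    α*gain≡ = trans (cong (α *_) (trans (gain≡ α) (ℚP.*-assoc (α - δ) (inv α) (inv (1ℚ - δ)))))
         (trans (solve 4 (λ a b c d → a :* (b :* (c :* d)) := (a :* c) :* (b :* d)) refl α (α - δ) (inv α) (inv (1ℚ - δ)))
                (cong (_* ((α - δ) * inv (1ℚ - δ))) (inv-inverseʳ α (0<⇒≢0 (ℚP.≤-<-trans 0≤δ δ<α)))))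

sumF-cong : ∀ {k} {f g : Fin k → ℚ} → (∀ i → f i ≡ g i) → sumF f ≡ sumF g
sumF-cong {zero} f≡g = refl
sumF-cong {suc k} f≡g = cong₂ _+_ (f≡g zero) (sumF-cong (λ i → f≡g (suc i)))

sumF-mono-≤ : ∀ {k} {f g : Fin k → ℚ} → (∀ i → f i Q.≤ g i) → sumF f Q.≤ sumF g
sumF-mono-≤ {zero} f≤g = ℚP.≤-refl
sumF-mono-≤ {suc k} f≤g = ℚP.+-mono-≤ (f≤g zero) (sumF-mono-≤ (λ i → f≤g (suc i)))

sumF-+ : ∀ {k} (f g : Fin k → ℚ) → sumF (λ i → f i + g i) ≡ sumF f + sumF g
sumF-+ {zero} f g = refl
sumF-+ {suc k} f g = trans (cong (f zero + g zero +_) (sumF-+ (λ i → f (suc i)) (λ i → g (suc i))))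
  (solve 4 (λ a b c d → (a :+ b) :+ (c :+ d) := (a :+ c) :+ (b :+ d)) refl
     (f zero) (g zero) (sumF (λ i → f (suc i))) (sumF (λ i → g (suc i))))

sumF-*ˡ : ∀ {k} (c : ℚ) (f : Fin k → ℚ) → sumF (λ i → c * f i) ≡ c * sumF f
sumF-*ˡ {zero} c f = sym (ℚP.*-zeroʳ c)
sumF-*ˡ {suc k} c f = trans (cong (c * f zero +_) (sumF-*ˡ c (λ i → f (suc i))))
  (sym (ℚP.*-distribˡ-+ c (f zero) (sumF (λ i → f (suc i)))))

sumF-*ʳ : ∀ {k} (c : ℚ) (f : Fin k → ℚ) → sumF (λ i → f i * c) ≡ sumF f * c
sumF-*ʳ c f = trans (sumF-cong (λ i → ℚP.*-comm (f i) c)) (trans (sumF-*ˡ c f) (ℚP.*-comm c (sumF f)))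

sumF-const : ∀ k (c : ℚ) → sumF {k} (λ _ → c) ≡ ℕ→ℚ k * c
sumF-const zero c = sym (ℚP.*-zeroˡ c)
sumF-const (suc k) c = begin
  c + sumF {k} (λ _ → c)   ≡⟨ cong (c +_) (sumF-const k c) ⟩
  c + ℕ→ℚ k * c            ≡⟨ solve 2 (λ c x → c :+ x :* c := (con 1ℚ :+ x) :* c) refl c (ℕ→ℚ k) ⟩
  (1ℚ + ℕ→ℚ k) * c         ≡⟨ cong (_* c) (ℕ→ℚ-suc k) ⟨
  ℕ→ℚ (suc k) * c          ∎
  where open ≡-Reasoning

sumF-zero : ∀ k → sumF {k} (λ _ → 0ℚ) ≡ 0ℚ
sumF-zero k = trans (sumF-const k 0ℚ) (ℚP.*-zeroʳ (ℕ→ℚ k))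

sumF-swap : ∀ {a b} (h : Fin a → Fin b → ℚ) →
  sumF (λ i → sumF (λ j → h i j)) ≡ sumF (λ j → sumF (λ i → h i j))
sumF-swap {zero} {b} h = sym (sumF-zero b)
sumF-swap {suc a} {b} h = begin
  sumF (h zero) + sumF (λ i → sumF (λ j → h (suc i) j))   ≡⟨ cong (sumF (h zero) +_) (sumF-swap (λ i j → h (suc i) j)) ⟩
  sumF (h zero) + sumF (λ j → sumF (λ i → h (suc i) j))   ≡⟨ sumF-+ (h zero) (λ j → sumF (λ i → h (suc i) j)) ⟨
  sumF (λ j → h zero j + sumF (λ i → h (suc i) j))        ∎
  where open ≡-Reasoning

countB-le : ∀ {m} (f : Fin m → Bool) → countB f ℕ.≤ m
countB-le {zero} f = z≤n
countB-le {suc m} f with f zero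
... | true = s≤s (countB-le (λ i → f (suc i)))
... | false = ℕP.m≤n⇒m≤1+n (countB-le (λ i → f (suc i)))

countB-cong : ∀ {m} {f g : Fin m → Bool} → (∀ i → f i ≡ g i) → countB f ≡ countB g
countB-cong {zero} f≡g = refl
countB-cong {suc m} f≡g = cong₂ ℕ._+_ (cong (λ b → if b then 1 else 0) (f≡g zero)) (countB-cong (λ i → f≡g (suc i)))

sumF-if : ∀ {k} (b : Fin k → Bool) u v →
  sumF (λ y → if b y then u else v) ≡ ℕ→ℚ (countB b) * u + (ℕ→ℚ k - ℕ→ℚ (countB b)) * v
sumF-if {zero} b u v = solve 2 (λ u v → con 0ℚ := con 0ℚ :* u :+ (con 0ℚ :- con 0ℚ) :* v) refl u v
sumF-if {suc k} b u v with b zero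
... | true = begin
  u + sumF (λ y → if b (suc y) then u else v)   ≡⟨ cong (u +_) (sumF-if (λ y → b (suc y)) u v) ⟩
  u + (C * u + (K - C) * v)                     ≡⟨ solve 4 (λ u v c k → u :+ (c :* u :+ (k :- c) :* v) := (con 1ℚ :+ c) :* u :+ ((con 1ℚ :+ k) :- (con 1ℚ :+ c)) :* v) refl u v C K ⟩
  (1ℚ + C) * u + ((1ℚ + K) - (1ℚ + C)) * v      ≡⟨ cong₂ (λ a b → a * u + (b - a) * v) (ℕ→ℚ-suc (countB (λ y → b (suc y)))) (ℕ→ℚ-suc k) ⟨
  ℕ→ℚ (suc (countB (λ y → b (suc y)))) * u + (ℕ→ℚ (suc k) - ℕ→ℚ (suc (countB (λ y → b (suc y))))) * v ∎
  where
  open ≡-Reasoning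
  C : ℚ
  C = ℕ→ℚ (countB (λ y → b (suc y)))
  K : ℚ
  K = ℕ→ℚ k
... | false = begin
  v + sumF (λ y → if b (suc y) then u else v)   ≡⟨ cong (v +_) (sumF-if (λ y → b (suc y)) u v) ⟩
  v + (C * u + (K - C) * v)                     ≡⟨ solve 4 (λ u v c k → v :+ (c :* u :+ (k :- c) :* v) := c :* u :+ ((con 1ℚ :+ k) :- c) :* v) refl u v C K ⟩
  C * u + ((1ℚ + K) - C) * v                    ≡⟨ cong (λ a → C * u + (a - C) * v) (ℕ→ℚ-suc k) ⟨
  C * u + (ℕ→ℚ (suc k) - C) * v                 ∎
  where
  open ≡-Reasoning
  C : ℚ
  C = ℕ→ℚ (countB (λ y → b (suc y)))
  K : ℚ
  K = ℕ→ℚ k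

prodF-cong : ∀ {m} {f g : Fin m → ℚ} → (∀ i → f i ≡ g i) → prodF f ≡ prodF g
prodF-cong {zero} f≡g = refl
prodF-cong {suc m} f≡g = cong₂ _*_ (f≡g zero) (prodF-cong (λ i → f≡g (suc i)))

prodF-update : ∀ {m} (f g : Fin m → ℚ) (i : Fin m) (c : ℚ) →
  (∀ j → j ≢ i → g j ≡ f j) → g i ≡ c * f i → prodF g ≡ c * prodF f
prodF-update {suc m} f g zero c g≡f gi≡cfi =
  trans (cong₂ _*_ gi≡cfi (prodF-cong (λ j → g≡f (suc j) (λ ())))) (ℚP.*-assoc c (f zero) _)
prodF-update {suc m} f g (suc i) c g≡f gi≡cfi =
  trans (cong₂ _*_ (g≡f zero (λ ()))
                   (prodF-update (λ j → f (suc j)) (λ j → g (suc j)) i c (λ j j≢i → g≡f (suc j) (λ e → j≢i (FinP.suc-injective e))) gi≡cfi))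
        (solve 3 (λ a c p → a :* (c :* p) := c :* (a :* p)) refl (f zero) c (prodF (λ j → f (suc j))))

inv-prodF : ∀ {m} (f g : Fin m → ℚ) → inv (prodF f) * prodF g ≡ prodF (λ j → inv (f j) * g j)
inv-prodF {zero} f g = refl
inv-prodF {suc m} f g = begin
  inv (f zero * F) * (g zero * G)            ≡⟨ cong (_* (g zero * G)) (inv-* (f zero) F) ⟩
  (inv (f zero) * inv F) * (g zero * G)      ≡⟨ solve 4 (λ a b c d → (a :* b) :* (c :* d) := (a :* c) :* (b :* d)) refl (inv (f zero)) (inv F) (g zero) G ⟩
  (inv (f zero) * g zero) * (inv F * G)      ≡⟨ cong ((inv (f zero) * g zero) *_) (inv-prodF (λ j → f (suc j)) (λ j → g (suc j))) ⟩
  (inv (f zero) * g zero) * prodF (λ j → inv (f (suc j)) * g (suc j)) ∎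
  where
  open ≡-Reasoning
  F : ℚ
  F = prodF (λ j → f (suc j))
  G : ℚ
  G = prodF (λ j → g (suc j))

ℕ→ℚ-product : ∀ {k} {A : Set} (g : A → ℕ) (f : Fin k → A) →
  ℕ→ℚ (L.foldr ℕ._*_ 1 (map g (tabulate f))) ≡ prodF (λ j → ℕ→ℚ (g (f j)))
ℕ→ℚ-product {zero} g f = refl
ℕ→ℚ-product {suc k} g f = trans (ℕ→ℚ-* (g (f zero)) _) (cong (ℕ→ℚ (g (f zero)) *_) (ℕ→ℚ-product g (λ j → f (suc j))))

consPoint : ∀ {m} {t : Fin (suc m) → ℕ} → Fin (t zero) → Point m (λ i → t (suc i)) → Point (suc m) t
consPoint y r zero = y
consPoint y r (suc i) = r i

_≈ᵖ_ : ∀ {m} {t : Fin m → ℕ} → Point m t → Point m t → Set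
q ≈ᵖ q′ = ∀ j → q j ≡ q′ j

-- Points are functions, so without function extensionality every function of a point has to be
-- shown to respect pointwise equality.
PointwiseCongruent : ∀ {m} {t : Fin m → ℕ} {A : Set} → (Point m t → A) → Set
PointwiseCongruent g = ∀ q q′ → q ≈ᵖ q′ → g q ≡ g q′

consPoint-cong : ∀ {m} {t : Fin (suc m) → ℕ} (y : Fin (t zero)) {r r′} → r ≈ᵖ r′ → consPoint {t = t} y r ≈ᵖ consPoint y r′
consPoint-cong y r≈r′ zero = refl
consPoint-cong y r≈r′ (suc j) = r≈r′ j

ΣP : ∀ {m} {t : Fin m → ℕ} → (Point m t → ℚ) → ℚ
ΣP {zero} g = g (λ ())
ΣP {suc m} g = sumF (λ y → ΣP (λ r → g (consPoint y r)))

ΣP-cong : ∀ {m} {t : Fin m → ℕ} {f g : Point m t → ℚ} → (∀ q → f q ≡ g q) → ΣP f ≡ ΣP g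
ΣP-cong {zero} f≡g = f≡g _
ΣP-cong {suc m} f≡g = sumF-cong (λ y → ΣP-cong (λ r → f≡g (consPoint y r)))

ΣP-mono-≤ : ∀ {m} {t : Fin m → ℕ} {f g : Point m t → ℚ} → (∀ q → f q Q.≤ g q) → ΣP f Q.≤ ΣP g
ΣP-mono-≤ {zero} f≤g = f≤g _
ΣP-mono-≤ {suc m} f≤g = sumF-mono-≤ (λ y → ΣP-mono-≤ (λ r → f≤g (consPoint y r)))

ΣP-*ˡ : ∀ {m} {t : Fin m → ℕ} (c : ℚ) (f : Point m t → ℚ) → ΣP (λ q → c * f q) ≡ c * ΣP f
ΣP-*ˡ {zero} c f = refl
ΣP-*ˡ {suc m} c f = trans (sumF-cong (λ y → ΣP-*ˡ c (λ r → f (consPoint y r)))) (sumF-*ˡ c (λ y → ΣP (λ r → f (consPoint y r))))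

ΣP-sumF : ∀ {m} {t : Fin m → ℕ} {k} (h : Fin k → Point m t → ℚ) → ΣP (λ q → sumF (λ y → h y q)) ≡ sumF (λ y → ΣP (h y))
ΣP-sumF {zero} h = refl
ΣP-sumF {suc m} h = trans (sumF-cong (λ y → ΣP-sumF (λ z r → h z (consPoint y r)))) (sumF-swap (λ z y → ΣP (λ r → h y (consPoint z r))))

Σᴸ : List ℚ → ℚ
Σᴸ = L.foldr _+_ 0ℚ

Σᴸ-++ : ∀ xs ys → Σᴸ (xs ++ ys) ≡ Σᴸ xs + Σᴸ ys
Σᴸ-++ [] ys = sym (ℚP.+-identityˡ (Σᴸ ys))
Σᴸ-++ (x ∷ xs) ys = trans (cong (x +_) (Σᴸ-++ xs ys)) (sym (ℚP.+-assoc x (Σᴸ xs) (Σᴸ ys)))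

Σᴸ-concatMap : ∀ {A B : Set} (g : B → ℚ) (h : A → List B) (xs : List A) →
  Σᴸ (map g (concatMap h xs)) ≡ Σᴸ (map (λ x → Σᴸ (map g (h x))) xs)
Σᴸ-concatMap g h [] = refl
Σᴸ-concatMap g h (x ∷ xs) = trans (cong Σᴸ (ListP.map-++ g (h x) (concatMap h xs)))
  (trans (Σᴸ-++ (map g (h x)) _) (cong (Σᴸ (map g (h x)) +_) (Σᴸ-concatMap g h xs)))

Σᴸ-tabulate : ∀ {k} (f : Fin k → ℚ) → Σᴸ (tabulate f) ≡ sumF f
Σᴸ-tabulate {zero} f = refl
Σᴸ-tabulate {suc k} f = cong (f zero +_) (Σᴸ-tabulate (λ i → f (suc i)))

Σᴸ-allPoints : ∀ {N} {S : Fin N → ℕ} {m} {t : Fin m → ℕ} (g : Point m t → ℚ) → PointwiseCongruent g →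
  Σᴸ (map g (allPoints {N} {S} {m} {t})) ≡ ΣP g
Σᴸ-allPoints {m = zero} g g-cong = trans (ℚP.+-identityʳ (g (λ ()))) (g-cong _ _ (λ ()))
Σᴸ-allPoints {N} {S} {m = suc m} {t} g g-cong =
  trans (Σᴸ-concatMap g _ (L.allFin (t zero))) (Σᴸ-byFirst _ (λ y r → λ { zero → refl ; (suc j) → refl }))
  where
  open ≡-Reasoning
  rest : List (Point m (λ i → t (suc i)))
  rest = allPoints {N} {S} {m} {λ i → t (suc i)}
  -- `allPoints` prepends a coordinate with a local copy of `consPoint`, known here only up to ≈ᵖ.
  Σᴸ-byFirst : (cons : Fin (t zero) → Point m (λ i → t (suc i)) → Point (suc m) t) →
    (∀ y r → cons y r ≈ᵖ consPoint y r) →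
    Σᴸ (map (λ y → Σᴸ (map g (map (cons y) rest))) (tabulate (λ y → y))) ≡ ΣP g
  Σᴸ-byFirst cons cons≈ = begin
    Σᴸ (map (λ y → Σᴸ (map g (map (cons y) rest))) (tabulate (λ y → y)))
      ≡⟨ cong Σᴸ (ListP.map-tabulate (λ y → y) inner) ⟩
    Σᴸ (tabulate (λ y → Σᴸ (map g (map (cons y) rest))))
      ≡⟨ Σᴸ-tabulate inner ⟩
    sumF (λ y → Σᴸ (map g (map (cons y) rest)))
      ≡⟨ sumF-cong (λ y → cong Σᴸ (sym (ListP.map-∘ {g = g} {f = cons y} rest))) ⟩
    sumF (λ y → Σᴸ (map (λ r → g (cons y r)) rest))
      ≡⟨ sumF-cong (λ y → Σᴸ-allPoints {N} {S} (λ r → g (cons y r)) (λ r r′ r≈r′ → g-cong _ _ (cons-cong y r≈r′))) ⟩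
    sumF (λ y → ΣP (λ r → g (cons y r)))
      ≡⟨ sumF-cong (λ y → ΣP-cong (λ r → g-cong _ _ (cons≈ y r))) ⟩
    ΣP g ∎
    where
    inner : Fin (t zero) → ℚ
    inner y = Σᴸ (map g (map (cons y) rest))
    cons-cong : ∀ y {r r′} → r ≈ᵖ r′ → cons y r ≈ᵖ cons y r′
    cons-cong y {r} {r′} r≈r′ j = trans (cons≈ y r j) (trans (consPoint-cong y r≈r′ j) (sym (cons≈ y r′ j)))

allB-cong : ∀ {m} {f g : Fin m → Bool} → (∀ i → f i ≡ g i) → allB f ≡ allB g
allB-cong {zero} f≡g = refl
allB-cong {suc m} f≡g = cong₂ _∧_ (f≡g zero) (allB-cong (λ i → f≡g (suc i)))

allB-elim : ∀ {m} {f : Fin m → Bool} → allB f ≡ true → ∀ i → f i ≡ true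
allB-elim {suc m} {f} all-f zero with f zero | all-f
... | true | _ = refl
allB-elim {suc m} {f} all-f (suc i) with f zero | all-f
... | true | all-rest = allB-elim all-rest i

anyL-cong : ∀ {A : Set} {f g : A → Bool} (xs : List A) → (∀ x → f x ≡ g x) → anyL f xs ≡ anyL g xs
anyL-cong [] f≡g = refl
anyL-cong (x ∷ xs) f≡g = cong₂ _∨_ (f≡g x) (anyL-cong xs f≡g)

<ᵇ≡false⇒≥ : ∀ a b → (a ℕ.<ᵇ b) ≡ false → b ℕ.≤ a
<ᵇ≡false⇒≥ a b a≮ᵇb = ℕP.≮⇒≥ (λ a<b → subst T a≮ᵇb (ℕP.<⇒<ᵇ a<b))

<⇒<ᵇ≡true : ∀ {a b} → a ℕ.< b → (a ℕ.<ᵇ b) ≡ true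
<⇒<ᵇ≡true a<b = Equivalence.to T-≡ (ℕP.<⇒<ᵇ a<b)

≢⇒<ᵇ-suc : ∀ a k → a ≢ k → (a ℕ.<ᵇ suc k) ≡ (a ℕ.<ᵇ k)
≢⇒<ᵇ-suc zero zero a≢k = ⊥-elim (a≢k refl)
≢⇒<ᵇ-suc zero (suc k) a≢k = refl
≢⇒<ᵇ-suc (suc a) zero a≢k = refl
≢⇒<ᵇ-suc (suc a) (suc k) a≢k = ≢⇒<ᵇ-suc a k (λ a≡k → a≢k (cong suc a≡k))

matches : ∀ {k} → Fin k → Maybe (Fin k) → Bool
matches x nothing = true
matches x (just a) = ⌊ x Fin.≟ a ⌋

card : ∀ {k} → Maybe (Fin k) → ℚ
card {k} nothing = ℕ→ℚ k
card (just _) = 1ℚ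

matches-cong : ∀ {k} {x x′ : Fin k} (a : Maybe (Fin k)) → (is-just a ≡ true → x ≡ x′) → matches x a ≡ matches x′ a
matches-cong nothing x≡x′ = refl
matches-cong (just a) x≡x′ rewrite x≡x′ refl = refl

ind : Bool → ℚ
ind b = if b then 1ℚ else 0ℚ

ind-∧ : ∀ a b → ind (a ∧ b) ≡ ind a * ind b
ind-∧ true b = sym (ℚP.*-identityˡ (ind b))
ind-∧ false b = sym (ℚP.*-zeroˡ (ind b))

sumF-ind-≟ : ∀ {k} (a : Fin k) → sumF (λ y → ind ⌊ y Fin.≟ a ⌋) ≡ 1ℚ
sumF-ind-≟ {suc k} zero = trans (cong (1ℚ +_) (trans (sumF-cong {k} {g = λ _ → 0ℚ} (λ y → refl)) (sumF-zero k))) (ℚP.+-identityʳ 1ℚ)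
sumF-ind-≟ {suc k} (suc a) = trans (ℚP.+-identityˡ _) (trans (sumF-cong {k} (λ y → cong ind (suc≟suc y))) (sumF-ind-≟ a))
  where
  suc≟suc : ∀ y → ⌊ suc y Fin.≟ suc a ⌋ ≡ ⌊ y Fin.≟ a ⌋
  suc≟suc y with y Fin.≟ a
  ... | yes _ = refl
  ... | no _ = refl

sumF-ind-matches : ∀ {k} (a : Maybe (Fin k)) → sumF (λ y → ind (matches y a)) ≡ card a
sumF-ind-matches {k} nothing = trans (sumF-const k 1ℚ) (ℚP.*-identityʳ (ℕ→ℚ k))
sumF-ind-matches (just a) = sumF-ind-≟ a

ΣP-ind-matches : ∀ {m} {t : Fin m → ℕ} (A : Hyperplane m t) →
  ΣP (λ q → ind (allB (λ j → matches (q j) (A j)))) ≡ prodF (λ j → card (A j))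
ΣP-ind-matches {zero} A = refl
ΣP-ind-matches {suc m} {t} A = begin
  sumF (λ y → ΣP (λ r → ind (matches y (A zero) ∧ inRest r)))
    ≡⟨ sumF-cong (λ y → ΣP-cong {m} (λ r → ind-∧ (matches y (A zero)) (inRest r))) ⟩
  sumF (λ y → ΣP (λ r → ind (matches y (A zero)) * ind (inRest r)))
    ≡⟨ sumF-cong (λ y → ΣP-*ˡ (ind (matches y (A zero))) (λ r → ind (inRest r))) ⟩
  sumF (λ y → ind (matches y (A zero)) * ΣP (λ r → ind (inRest r)))
    ≡⟨ sumF-cong (λ y → cong (ind (matches y (A zero)) *_) (ΣP-ind-matches (λ j → A (suc j)))) ⟩
  sumF (λ y → ind (matches y (A zero)) * P)
    ≡⟨ sumF-*ʳ P (λ y → ind (matches y (A zero))) ⟩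
  sumF (λ y → ind (matches y (A zero))) * P
    ≡⟨ cong (_* P) (sumF-ind-matches (A zero)) ⟩
  card (A zero) * P ∎
  where
  open ≡-Reasoning
  inRest : Point m (λ i → t (suc i)) → Bool
  inRest r = allB (λ j → matches (r j) (A (suc j)))
  P : ℚ
  P = prodF (λ j → card (A (suc j)))

module _ {n : ℕ} {s : Fin n → ℕ} where

  upd-same : ∀ (q : Point n s) i y → upd q i y i ≡ y
  upd-same q i y with i Fin.≟ i
  ... | yes refl = refl
  ... | no i≢i = ⊥-elim (i≢i refl)

  upd-other : ∀ (q : Point n s) i y j → j ≢ i → upd q i y j ≡ q j
  upd-other q i y j j≢i with j Fin.≟ i
  ... | yes refl = ⊥-elim (j≢i refl)
  ... | no _ = refl

  upd-cong : ∀ {q q′ : Point n s} i y j → (j ≢ i → q j ≡ q′ j) → upd q i y j ≡ upd q′ i y j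
  upd-cong i y j q≡q′ with j Fin.≟ i
  ... | yes refl = refl
  ... | no j≢i = q≡q′ j≢i

  -- `inA` tests coordinates with a local function that cannot be named here; `coordinateTests`
  -- recovers it from the type of `refl`, so that `with A i` can unfold it.
  coordinateTests : ∀ {m} {f : Fin m → Bool} {b : Bool} → allB f ≡ b → Fin m → Bool
  coordinateTests {f = f} _ = f

  inA≡allB-matches : ∀ (A : Hyperplane n s) q → inA A q ≡ allB (λ i → matches (q i) (A i))
  inA≡allB-matches A q = allB-cong tests≡matches
    where
    tests≡matches : ∀ i → coordinateTests {b = inA A q} refl i ≡ matches (q i) (A i)
    tests≡matches i with A i
    ... | nothing = refl
    ... | just a = refl

  inA-cong : ∀ (A : Hyperplane n s) {q q′} → (∀ j → fixed A j ≡ true → q j ≡ q′ j) → inA A q ≡ inA A q′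
  inA-cong A {q} {q′} q≡q′ = trans (inA≡allB-matches A q)
    (trans (allB-cong (λ j → matches-cong (A j) (q≡q′ j))) (sym (inA≡allB-matches A q′)))

  maxFis⇒fixed≤ : ∀ (A : Hyperplane n s) i → maxFis A i ≡ true → ∀ j → fixed A j ≡ true → toℕ j ℕ.≤ toℕ i
  maxFis⇒fixed≤ A i max≡i j fixed-j with fixed A i | max≡i
  ... | true | above-free = i-bounds (allB-elim above-free j)
    where
    i-bounds : (not (toℕ i ℕ.<ᵇ toℕ j) ∨ not (fixed A j)) ≡ true → toℕ j ℕ.≤ toℕ i
    i-bounds i≮j∨free with toℕ i ℕ.<ᵇ toℕ j in i<ᵇj
    ... | false = <ᵇ≡false⇒≥ (toℕ i) (toℕ j) i<ᵇj
    ... | true rewrite fixed-j with () ← i≮j∨free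

  inB-cong : ∀ (𝒜 : List (Hyperplane n s)) i {q q′} → (∀ j → toℕ j ℕ.≤ toℕ i → q j ≡ q′ j) → inB 𝒜 i q ≡ inB 𝒜 i q′
  inB-cong 𝒜 i {q} {q′} q≡q′ = anyL-cong 𝒜 same-test
    where
    same-test : ∀ A → (maxFis A i ∧ inA A q) ≡ (maxFis A i ∧ inA A q′)
    same-test A with maxFis A i in max≡i
    ... | false = refl
    ... | true = inA-cong A (λ j fixed-j → q≡q′ j (maxFis⇒fixed≤ A i max≡i j fixed-j))

upd-consPoint-suc : ∀ {m} {t : Fin (suc m) → ℕ} (y₀ : Fin (t zero)) (r : Point m (λ i → t (suc i))) i y →
  upd {suc m} {t} (consPoint y₀ r) (suc i) y ≈ᵖ consPoint y₀ (upd r i y)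
upd-consPoint-suc {m} {t} y₀ r i y zero = upd-other {suc m} {t} (consPoint y₀ r) (suc i) y zero (λ ())
upd-consPoint-suc {m} {t} y₀ r i y (suc j) = by-cases (j Fin.≟ i)
  where
  by-cases : Dec (j ≡ i) → upd {suc m} {t} (consPoint y₀ r) (suc i) y (suc j) ≡ upd r i y j
  by-cases (yes refl) = trans (upd-same {suc m} {t} (consPoint y₀ r) (suc j) y) (sym (upd-same {m} {λ i → t (suc i)} r j y))
  by-cases (no j≢i) = trans (upd-other {suc m} {t} (consPoint y₀ r) (suc i) y (suc j) (λ e → j≢i (FinP.suc-injective e)))
                            (sym (upd-other {m} {λ i → t (suc i)} r i y j j≢i))

upd-consPoint-zero : ∀ {m} {t : Fin (suc m) → ℕ} (y₀ : Fin (t zero)) (r : Point m (λ i → t (suc i))) y →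
  upd {suc m} {t} (consPoint y₀ r) zero y ≈ᵖ consPoint y r
upd-consPoint-zero {m} {t} y₀ r y zero = upd-same {suc m} {t} (consPoint y₀ r) zero y
upd-consPoint-zero {m} {t} y₀ r y (suc j) = upd-other {suc m} {t} (consPoint y₀ r) zero y (suc j) (λ ())

ΣP-resample : ∀ {m} {t : Fin m → ℕ} (i : Fin m) (g : Point m t → ℚ) → PointwiseCongruent g →
  ΣP (λ q → sumF (λ y → g (upd q i y))) ≡ ℕ→ℚ (t i) * ΣP g
ΣP-resample {suc m} {t} zero g g-cong = begin
  sumF (λ y₀ → ΣP (λ r → sumF (λ y → g (upd (consPoint y₀ r) zero y))))
    ≡⟨ sumF-cong (λ y₀ → ΣP-cong (λ r → sumF-cong (λ y → g-cong _ _ (upd-consPoint-zero y₀ r y)))) ⟩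
  sumF {t zero} (λ _ → ΣP {m} {λ i → t (suc i)} (λ r → sumF (λ y → g (consPoint y r))))
    ≡⟨ sumF-cong {t zero} (λ _ → ΣP-sumF {m} {λ i → t (suc i)} {t zero} (λ y r → g (consPoint y r))) ⟩
  sumF {t zero} (λ _ → ΣP g)
    ≡⟨ sumF-const (t zero) (ΣP g) ⟩
  ℕ→ℚ (t zero) * ΣP g ∎
  where open ≡-Reasoning
ΣP-resample {suc m} {t} (suc i) g g-cong = begin
  sumF (λ y₀ → ΣP (λ r → sumF (λ y → g (upd (consPoint y₀ r) (suc i) y))))
    ≡⟨ sumF-cong (λ y₀ → ΣP-cong (λ r → sumF-cong (λ y → g-cong _ _ (upd-consPoint-suc y₀ r i y)))) ⟩
  sumF (λ y₀ → ΣP (λ r → sumF (λ y → g (consPoint y₀ (upd r i y)))))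
    ≡⟨ sumF-cong (λ y₀ → ΣP-resample i (λ r → g (consPoint y₀ r)) (λ r r′ r≈r′ → g-cong _ _ (consPoint-cong y₀ r≈r′))) ⟩
  sumF (λ y₀ → ℕ→ℚ (t (suc i)) * ΣP (λ r → g (consPoint y₀ r)))
    ≡⟨ sumF-*ˡ (ℕ→ℚ (t (suc i))) (λ y₀ → ΣP (λ r → g (consPoint y₀ r))) ⟩
  ℕ→ℚ (t (suc i)) * ΣP g ∎
  where open ≡-Reasoning

ΣP-≤-byResampling : ∀ {m} {t : Fin m → ℕ} (i : Fin m) {f g : Point m t → ℚ} → PointwiseCongruent f →
  0ℚ Q.< ℕ→ℚ (t i) → (∀ q → sumF (λ y → f (upd q i y)) Q.≤ ℕ→ℚ (t i) * g q) → ΣP f Q.≤ ΣP g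
ΣP-≤-byResampling {t = t} i {f} {g} f-cong 0<tᵢ fibre-bound =
  ℚP.*-cancelˡ-≤-pos (ℕ→ℚ (t i)) {{Q.positive 0<tᵢ}} (begin
    ℕ→ℚ (t i) * ΣP f                    ≡⟨ ΣP-resample i f f-cong ⟨
    ΣP (λ q → sumF (λ y → f (upd q i y))) ≤⟨ ΣP-mono-≤ fibre-bound ⟩
    ΣP (λ q → ℕ→ℚ (t i) * g q)           ≡⟨ ΣP-*ˡ (ℕ→ℚ (t i)) g ⟩
    ℕ→ℚ (t i) * ΣP g                    ∎)
  where open ℚP.≤-Reasoning

false≢true : false ≢ true
false≢true ()

<ᵇ-irrefl : ∀ a → (a ℕ.<ᵇ a) ≡ false
<ᵇ-irrefl zero = refl
<ᵇ-irrefl (suc a) = <ᵇ-irrefl a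

if-*ˡ : ∀ (b : Bool) c x → (if b then c * x else 0ℚ) ≡ c * (if b then x else 0ℚ)
if-*ˡ true c x = refl
if-*ˡ false c x = sym (ℚP.*-zeroʳ c)

if-const : ∀ (b : Bool) c → (if b then c else 0ℚ) ≡ c * ind b
if-const true c = sym (ℚP.*-identityʳ c)
if-const false c = sym (ℚP.*-zeroʳ c)

½<1 : ½ Q.< 1ℚ
½<1 = Q.*<* (ℤ.+<+ (s≤s (s≤s z≤n)))

module Bound {n : ℕ} {s : Fin n → ℕ} (𝒜 : List (Hyperplane n s)) (δ : ℚ)
             (0≤δ : 0ℚ Q.≤ δ) (δ<1 : δ Q.< 1ℚ) (1≤s : ∀ i → 1 ℕ.≤ s i) where
  open Factors δ 0≤δ δ<1

  0<S : ∀ i → 0ℚ Q.< ℕ→ℚ (s i)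
  0<S i with s i | 1≤s i
  ... | suc m | _ = ℕ→ℚ-suc-pos m

  α : Fin n → Point n s → ℚ
  α i q = ℕ→ℚ (countB (λ y → inB 𝒜 i (upd q i y))) * inv (ℕ→ℚ (s i))

  densityFactor : Fin n → Point n s → ℚ
  densityFactor i q = factor (inB 𝒜 i q) (α i q)

  -- The factor is read off `Pk` by unification rather than written out: checking the written-out
  -- form by conversion unfolds the rational arithmetic on both sides and is very slow.
  Pk-suc-factor : ∀ k (k<n : k ℕ.< n) q → Σ ℚ λ a →
    Pk 𝒜 δ (suc k) q ≡ factor (inB 𝒜 (fromℕ< k<n) q) a * Pk 𝒜 δ k q × a ≡ α (fromℕ< k<n) q
  Pk-suc-factor k k<n q with k ℕ.<? n
  ... | yes _ = _ , refl , refl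
  ... | no k≮n = ⊥-elim (k≮n k<n)

  Pk-suc : ∀ k (k<n : k ℕ.< n) q → Pk 𝒜 δ (suc k) q ≡ densityFactor (fromℕ< k<n) q * Pk 𝒜 δ k q
  Pk-suc k k<n q = trans (proj₁ (proj₂ (Pk-suc-factor k k<n q)))
    (cong (λ a → factor (inB 𝒜 (fromℕ< k<n) q) a * Pk 𝒜 δ k q) (proj₂ (proj₂ (Pk-suc-factor k k<n q))))

  α-nonNeg : ∀ i q → 0ℚ Q.≤ α i q
  α-nonNeg i q = 0≤*0≤⇒0≤ (ℕ→ℚ-nonNeg (countB (λ y → inB 𝒜 i (upd q i y)))) (inv-nonNeg (ℚP.<⇒≤ (0<S i)))

  α≤1 : ∀ i q → α i q Q.≤ 1ℚ
  α≤1 i q = ℚP.≤-trans (*-monoʳ-≤-0≤ (inv-nonNeg (ℚP.<⇒≤ (0<S i))) (ℕ→ℚ-mono-≤ (countB-le (λ y → inB 𝒜 i (upd q i y)))))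
                       (ℚP.≤-reflexive (inv-inverseʳ (ℕ→ℚ (s i)) (0<⇒≢0 (0<S i))))

  α-cong : ∀ i {q q′} → (∀ j → toℕ j ℕ.< toℕ i → q j ≡ q′ j) → α i q ≡ α i q′
  α-cong i q≡q′ = cong (λ c → ℕ→ℚ c * inv (ℕ→ℚ (s i)))
    (countB-cong (λ y → inB-cong 𝒜 i (λ j j≤i → upd-cong i y j
      (λ j≢i → q≡q′ j (ℕP.≤∧≢⇒< j≤i (λ e → j≢i (FinP.toℕ-injective e)))))))

  densityFactor-cong : ∀ i {q q′} → (∀ j → toℕ j ℕ.≤ toℕ i → q j ≡ q′ j) → densityFactor i q ≡ densityFactor i q′
  densityFactor-cong i q≡q′ = cong₂ factor (inB-cong 𝒜 i q≡q′) (α-cong i (λ j j<i → q≡q′ j (ℕP.<⇒≤ j<i)))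

  densityFactor-nonNeg : ∀ i q → 0ℚ Q.≤ densityFactor i q
  densityFactor-nonNeg i q = factor-nonNeg (inB 𝒜 i q) (α≤1 i q)

  densityFactor≤inv[1-δ] : ∀ i q → densityFactor i q Q.≤ inv (1ℚ - δ)
  densityFactor≤inv[1-δ] i q = factor≤inv[1-δ] (inB 𝒜 i q) (α-nonNeg i q)

  fibre-sum≤card : ∀ i q → sumF (λ y → densityFactor i (upd q i y)) Q.≤ ℕ→ℚ (s i)
  fibre-sum≤card i q = begin
    sumF (λ y → densityFactor i (upd q i y))
      ≡⟨ sumF-cong (λ y → cong (factor (inB 𝒜 i (upd q i y))) (α-cong i (λ j j<i → upd-other q i y j (λ e → ℕP.<-irrefl (cong toℕ e) j<i)))) ⟩
    sumF (λ y → if inB 𝒜 i (upd q i y) then factorIn a else factorOut a)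
      ≡⟨ sumF-if (λ y → inB 𝒜 i (upd q i y)) (factorIn a) (factorOut a) ⟩
    C * factorIn a + (ℕ→ℚ (s i) - C) * factorOut a
      ≡⟨ cong (λ c → c * factorIn a + (ℕ→ℚ (s i) - c) * factorOut a) C≡a*S ⟩
    (a * ℕ→ℚ (s i)) * factorIn a + (ℕ→ℚ (s i) - a * ℕ→ℚ (s i)) * factorOut a
      ≡⟨ solve 4 (λ a s u v → (a :* s) :* u :+ (s :- a :* s) :* v := s :* (a :* u :+ (con 1ℚ :- a) :* v)) refl a (ℕ→ℚ (s i)) (factorIn a) (factorOut a) ⟩
    ℕ→ℚ (s i) * (a * factorIn a + (1ℚ - a) * factorOut a)
      ≤⟨ *-monoˡ-≤-0≤ (ℚP.<⇒≤ (0<S i)) (factor-average≤1 (α-nonNeg i q) (α≤1 i q)) ⟩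
    ℕ→ℚ (s i) * 1ℚ
      ≡⟨ ℚP.*-identityʳ (ℕ→ℚ (s i)) ⟩
    ℕ→ℚ (s i) ∎
    where
    open ℚP.≤-Reasoning
    a : ℚ
    a = α i q
    C : ℚ
    C = ℕ→ℚ (countB (λ y → inB 𝒜 i (upd q i y)))
    C≡a*S : C ≡ a * ℕ→ℚ (s i)
    C≡a*S = sym (trans (ℚP.*-assoc C (inv (ℕ→ℚ (s i))) (ℕ→ℚ (s i)))
              (trans (cong (C *_) (trans (ℚP.*-comm (inv (ℕ→ℚ (s i))) (ℕ→ℚ (s i))) (inv-inverseʳ (ℕ→ℚ (s i)) (0<⇒≢0 (0<S i)))))
                     (ℚP.*-identityʳ C)))

  Pk-cong : ∀ k → k ℕ.≤ n → ∀ {q q′} → (∀ j → toℕ j ℕ.< k → q j ≡ q′ j) → Pk 𝒜 δ k q ≡ Pk 𝒜 δ k q′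
  Pk-cong zero _ _ = refl
  Pk-cong (suc k) k<n {q} {q′} q≡q′ = begin
    Pk 𝒜 δ (suc k) q                     ≡⟨ Pk-suc k k<n q ⟩
    densityFactor i q * Pk 𝒜 δ k q       ≡⟨ cong₂ _*_ (densityFactor-cong i (λ j j≤i → q≡q′ j (s≤s (subst (toℕ j ℕ.≤_) (FinP.toℕ-fromℕ< k<n) j≤i))))
                                                      (Pk-cong k (ℕP.<⇒≤ k<n) (λ j j<k → q≡q′ j (ℕP.m<n⇒m<1+n j<k))) ⟩
    densityFactor i q′ * Pk 𝒜 δ k q′     ≡⟨ Pk-suc k k<n q′ ⟨
    Pk 𝒜 δ (suc k) q′                    ∎
    where
    open ≡-Reasoning
    i : Fin n
    i = fromℕ< k<n

  Pk-nonNeg : ∀ k → k ℕ.≤ n → ∀ q → 0ℚ Q.≤ Pk 𝒜 δ k q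
  Pk-nonNeg zero _ q = inv-nonNeg (ℕ→ℚ-nonNeg (sizeQ {n} {s}))
  Pk-nonNeg (suc k) k<n q = subst (0ℚ Q.≤_) (sym (Pk-suc k k<n q))
    (0≤*0≤⇒0≤ (densityFactor-nonNeg (fromℕ< k<n) q) (Pk-nonNeg k (ℕP.<⇒≤ k<n) q))

  restrict : Hyperplane n s → (Point n s → ℚ) → Point n s → ℚ
  restrict A f q = if inA A q then f q else 0ℚ

  restrict-Pk-nonNeg : ∀ k → k ℕ.≤ n → ∀ A q → 0ℚ Q.≤ restrict A (Pk 𝒜 δ k) q
  restrict-Pk-nonNeg k k≤n A q with inA A q
  ... | true = Pk-nonNeg k k≤n q
  ... | false = ℚP.≤-refl

  restrict-Pk-cong : ∀ k → k ℕ.≤ n → ∀ A {q q′} → (∀ j → fixed A j ≡ true → q j ≡ q′ j) →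
    (∀ j → toℕ j ℕ.< k → q j ≡ q′ j) → restrict A (Pk 𝒜 δ k) q ≡ restrict A (Pk 𝒜 δ k) q′
  restrict-Pk-cong k k≤n A onF onFirst =
    cong₂ (λ b x → if b then x else 0ℚ) (inA-cong A onF) (Pk-cong k k≤n onFirst)

  restrict-Pk-suc : ∀ k (k<n : k ℕ.< n) A q →
    restrict A (Pk 𝒜 δ (suc k)) q ≡ densityFactor (fromℕ< k<n) q * restrict A (Pk 𝒜 δ k) q
  restrict-Pk-suc k k<n A q = trans (cong (λ x → if inA A q then x else 0ℚ) (Pk-suc k k<n q))
                                    (if-*ˡ (inA A q) (densityFactor (fromℕ< k<n) q) (Pk 𝒜 δ k q))

  measure≡ΣP : ∀ k → k ℕ.≤ n → ∀ A → measure 𝒜 δ k A ≡ ΣP (restrict A (Pk 𝒜 δ k))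
  measure≡ΣP k k≤n A = Σᴸ-allPoints {n} {s} (restrict A (Pk 𝒜 δ k))
    (λ q q′ q≈q′ → restrict-Pk-cong k k≤n A (λ j _ → q≈q′ j) (λ j _ → q≈q′ j))

  scaledCard : ℕ → Fin n → ℚ
  scaledCard k j = if toℕ j ℕ.<ᵇ k then (1ℚ - δ) * ℕ→ℚ (s j) else ℕ→ℚ (s j)

  boundFactor : ℕ → Hyperplane n s → Fin n → ℚ
  boundFactor k A j = if fixed A j then inv (scaledCard k j) else 1ℚ

  partialBound : ℕ → Hyperplane n s → ℚ
  partialBound k A = prodF (boundFactor k A)

  boundFactor-suc : ∀ k A j → (fixed A j ≡ true → toℕ j ≢ k) → boundFactor (suc k) A j ≡ boundFactor k A j
  boundFactor-suc k A j fixed⇒j≢k with fixed A j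
  ... | false = refl
  ... | true = cong (λ b → inv (if b then (1ℚ - δ) * ℕ→ℚ (s j) else ℕ→ℚ (s j))) (≢⇒<ᵇ-suc (toℕ j) k (fixed⇒j≢k refl))

  boundFactor-suc-self : ∀ A i → fixed A i ≡ true → boundFactor (suc (toℕ i)) A i ≡ inv (1ℚ - δ) * boundFactor (toℕ i) A i
  boundFactor-suc-self A i fixed-i rewrite fixed-i = begin
    inv (if toℕ i ℕ.<ᵇ suc (toℕ i) then (1ℚ - δ) * ℕ→ℚ (s i) else ℕ→ℚ (s i))
      ≡⟨ cong (λ b → inv (if b then (1ℚ - δ) * ℕ→ℚ (s i) else ℕ→ℚ (s i))) (<⇒<ᵇ≡true (ℕP.n<1+n (toℕ i))) ⟩
    inv ((1ℚ - δ) * ℕ→ℚ (s i))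
      ≡⟨ inv-* (1ℚ - δ) (ℕ→ℚ (s i)) ⟩
    inv (1ℚ - δ) * inv (ℕ→ℚ (s i))
      ≡⟨ cong (λ b → inv (1ℚ - δ) * inv (if b then (1ℚ - δ) * ℕ→ℚ (s i) else ℕ→ℚ (s i))) (<ᵇ-irrefl (toℕ i)) ⟨
    inv (1ℚ - δ) * inv (if toℕ i ℕ.<ᵇ toℕ i then (1ℚ - δ) * ℕ→ℚ (s i) else ℕ→ℚ (s i)) ∎
    where open ≡-Reasoning

  partialBound-suc-fixed : ∀ k (k<n : k ℕ.< n) A → fixed A (fromℕ< k<n) ≡ true →
    partialBound (suc k) A ≡ inv (1ℚ - δ) * partialBound k A
  partialBound-suc-fixed k k<n A fixed-i =
    prodF-update (boundFactor k A) (boundFactor (suc k) A) i (inv (1ℚ - δ))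
      (λ j j≢i → boundFactor-suc k A j (λ _ j≡k → j≢i (FinP.toℕ-injective (trans j≡k (sym toℕi≡k)))))
      (subst (λ k → boundFactor (suc k) A i ≡ inv (1ℚ - δ) * boundFactor k A i) toℕi≡k (boundFactor-suc-self A i fixed-i))
    where
    i : Fin n
    i = fromℕ< k<n
    toℕi≡k : toℕ i ≡ k
    toℕi≡k = FinP.toℕ-fromℕ< k<n

  partialBound-suc-free : ∀ k (k<n : k ℕ.< n) A → fixed A (fromℕ< k<n) ≡ false →
    partialBound (suc k) A ≡ partialBound k A
  partialBound-suc-free k k<n A free-i = prodF-cong (λ j → boundFactor-suc k A j (λ fixed-j j≡k →
    false≢true (trans (sym free-i) (subst (λ j → fixed A j ≡ true) (FinP.toℕ-injective (trans j≡k (sym (FinP.toℕ-fromℕ< k<n)))) fixed-j))))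

  partialBound₀ : ∀ A → ΣP (restrict A (Pk 𝒜 δ 0)) ≡ partialBound 0 A
  partialBound₀ A = begin
    ΣP (restrict A (λ _ → 1/|Q|))
      ≡⟨ ΣP-cong (λ q → trans (if-const (inA A q) 1/|Q|) (cong (λ b → 1/|Q| * ind b) (inA≡allB-matches A q))) ⟩
    ΣP (λ q → 1/|Q| * ind (allB (λ j → matches (q j) (A j))))
      ≡⟨ ΣP-*ˡ 1/|Q| (λ q → ind (allB (λ j → matches (q j) (A j)))) ⟩
    1/|Q| * ΣP (λ q → ind (allB (λ j → matches (q j) (A j))))
      ≡⟨ cong (1/|Q| *_) (ΣP-ind-matches A) ⟩
    1/|Q| * prodF (λ j → card (A j))
      ≡⟨ cong (λ z → inv z * prodF (λ j → card (A j))) (ℕ→ℚ-product s (λ j → j)) ⟩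
    inv (prodF (λ j → ℕ→ℚ (s j))) * prodF (λ j → card (A j))
      ≡⟨ inv-prodF (λ j → ℕ→ℚ (s j)) (λ j → card (A j)) ⟩
    prodF (λ j → inv (ℕ→ℚ (s j)) * card (A j))
      ≡⟨ prodF-cong boundFactor₀ ⟩
    partialBound 0 A ∎
    where
    open ≡-Reasoning
    1/|Q| : ℚ
    1/|Q| = inv (ℕ→ℚ (sizeQ {n} {s}))
    boundFactor₀ : ∀ j → inv (ℕ→ℚ (s j)) * card (A j) ≡ boundFactor 0 A j
    boundFactor₀ j with A j
    ... | nothing = trans (ℚP.*-comm (inv (ℕ→ℚ (s j))) (ℕ→ℚ (s j))) (inv-inverseʳ (ℕ→ℚ (s j)) (0<⇒≢0 (0<S j)))
    ... | just _ = ℚP.*-identityʳ (inv (ℕ→ℚ (s j)))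

  ΣP-restrict-suc-fixed : ∀ k (k<n : k ℕ.< n) A →
    ΣP (restrict A (Pk 𝒜 δ (suc k))) Q.≤ inv (1ℚ - δ) * ΣP (restrict A (Pk 𝒜 δ k))
  ΣP-restrict-suc-fixed k k<n A = begin
    ΣP (restrict A (Pk 𝒜 δ (suc k)))                            ≡⟨ ΣP-cong (restrict-Pk-suc k k<n A) ⟩
    ΣP (λ q → densityFactor i q * restrict A (Pk 𝒜 δ k) q)     ≤⟨ ΣP-mono-≤ (λ q → *-monoʳ-≤-0≤ (restrict-Pk-nonNeg k (ℕP.<⇒≤ k<n) A q) (densityFactor≤inv[1-δ] i q)) ⟩
    ΣP (λ q → inv (1ℚ - δ) * restrict A (Pk 𝒜 δ k) q)                 ≡⟨ ΣP-*ˡ (inv (1ℚ - δ)) (restrict A (Pk 𝒜 δ k)) ⟩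
    inv (1ℚ - δ) * ΣP (restrict A (Pk 𝒜 δ k))                          ∎
    where
    open ℚP.≤-Reasoning
    i : Fin n
    i = fromℕ< k<n

  ΣP-restrict-suc-free : ∀ k (k<n : k ℕ.< n) A → fixed A (fromℕ< k<n) ≡ false →
    ΣP (restrict A (Pk 𝒜 δ (suc k))) Q.≤ ΣP (restrict A (Pk 𝒜 δ k))
  ΣP-restrict-suc-free k k<n A free-i = ΣP-≤-byResampling i
    (λ q q′ q≈q′ → restrict-Pk-cong (suc k) k<n A (λ j _ → q≈q′ j) (λ j _ → q≈q′ j)) (0<S i) fibre-bound
    where
    open ℚP.≤-Reasoning
    i : Fin n
    i = fromℕ< k<n
    R : Point n s → ℚ
    R = restrict A (Pk 𝒜 δ k)
    R-upd : ∀ q y → R (upd q i y) ≡ R q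
    R-upd q y = restrict-Pk-cong k (ℕP.<⇒≤ k<n) A
      (λ j fixed-j → upd-other q i y j (λ { refl → false≢true (trans (sym free-i) fixed-j) }))
      (λ j j<k → upd-other q i y j (λ { refl → ℕP.<-irrefl (FinP.toℕ-fromℕ< k<n) j<k }))
    fibre-bound : ∀ q → sumF (λ y → restrict A (Pk 𝒜 δ (suc k)) (upd q i y)) Q.≤ ℕ→ℚ (s i) * R q
    fibre-bound q = begin
      sumF (λ y → restrict A (Pk 𝒜 δ (suc k)) (upd q i y))  ≡⟨ sumF-cong (λ y → restrict-Pk-suc k k<n A (upd q i y)) ⟩
      sumF (λ y → densityFactor i (upd q i y) * R (upd q i y)) ≡⟨ sumF-cong (λ y → cong (densityFactor i (upd q i y) *_) (R-upd q y)) ⟩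
      sumF (λ y → densityFactor i (upd q i y) * R q)          ≡⟨ sumF-*ʳ (R q) (λ y → densityFactor i (upd q i y)) ⟩
      sumF (λ y → densityFactor i (upd q i y)) * R q          ≤⟨ *-monoʳ-≤-0≤ (restrict-Pk-nonNeg k (ℕP.<⇒≤ k<n) A q) (fibre-sum≤card i q) ⟩
      ℕ→ℚ (s i) * R q                                               ∎

  ΣP-restrict-Pk≤partialBound : ∀ k → k ℕ.≤ n → ∀ A → ΣP (restrict A (Pk 𝒜 δ k)) Q.≤ partialBound k A
  ΣP-restrict-Pk≤partialBound zero _ A = ℚP.≤-reflexive (partialBound₀ A)
  ΣP-restrict-Pk≤partialBound (suc k) k<n A with fixed A (fromℕ< k<n) in fixed-i
  ... | true = begin
    ΣP (restrict A (Pk 𝒜 δ (suc k)))      ≤⟨ ΣP-restrict-suc-fixed k k<n A ⟩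
    inv (1ℚ - δ) * ΣP (restrict A (Pk 𝒜 δ k))    ≤⟨ *-monoˡ-≤-0≤ 0≤inv[1-δ] (ΣP-restrict-Pk≤partialBound k (ℕP.<⇒≤ k<n) A) ⟩
    inv (1ℚ - δ) * partialBound k A              ≡⟨ partialBound-suc-fixed k k<n A fixed-i ⟨
    partialBound (suc k) A                ∎
    where open ℚP.≤-Reasoning
  ... | false = begin
    ΣP (restrict A (Pk 𝒜 δ (suc k)))      ≤⟨ ΣP-restrict-suc-free k k<n A fixed-i ⟩
    ΣP (restrict A (Pk 𝒜 δ k))            ≤⟨ ΣP-restrict-Pk≤partialBound k (ℕP.<⇒≤ k<n) A ⟩
    partialBound k A                      ≡⟨ partialBound-suc-free k k<n A fixed-i ⟨
    partialBound (suc k) A                ∎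
    where open ℚP.≤-Reasoning

  partialBound≡bound : ∀ k A → (∀ j → fixed A j ≡ true → toℕ j ℕ.< k) → partialBound k A ≡ bound δ A
  partialBound≡bound k A F⊆k = prodF-cong boundFactor≡
    where
    boundFactor≡ : ∀ j → boundFactor k A j ≡ (if fixed A j then inv ((1ℚ - δ) * ℕ→ℚ (s j)) else 1ℚ)
    boundFactor≡ j with fixed A j in fixed-j
    ... | false = refl
    ... | true rewrite <⇒<ᵇ≡true (F⊆k j fixed-j) = refl

lemma4p2 : (n : ℕ) → 1 ≤ n → (s : Fin n → ℕ) → (∀ i → 2 ≤ s i)
    → (δ : ℚ) → 0ℚ Data.Rational.≤ δ → δ Data.Rational.≤ ½
    → (𝒜 : List (Hyperplane n s)) → (A : Hyperplane n s)
    → (k : ℕ) → k ≤ n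
    → (∀ (i : Fin n) → fixed A i ≡ true → toℕ i < k)
    → measure 𝒜 δ k A Data.Rational.≤ bound δ A
lemma4p2 n _ s 2≤s δ 0≤δ δ≤½ 𝒜 A k k≤n F⊆k = begin
  measure 𝒜 δ k A                  ≡⟨ measure≡ΣP k k≤n A ⟩
  ΣP (restrict A (Pk 𝒜 δ k))       ≤⟨ ΣP-restrict-Pk≤partialBound k k≤n A ⟩
  partialBound k A                 ≡⟨ partialBound≡bound k A F⊆k ⟩
  bound δ A                        ∎
  where
  open ℚP.≤-Reasoning
  open Bound 𝒜 δ 0≤δ (ℚP.≤-<-trans δ≤½ ½<1) (λ i → ℕP.<⇒≤ (2≤s i))
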